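{- Let $\mathsf{K}$ be a variety of modal lattices, and let $\overline{p}$, $\overline{q}$, $\overline{r}$ be pairwise disjoint sets of propositional letters. For a set of letters $P$, write $F_{\mathsf K}(P)$ for the free algebra of $\mathsf K$ on $P$, and consider the natural embeddings $F_{\mathsf K}(\overline p)\hookrightarrow F_{\mathsf K}(\overline p,\overline q)$, $F_{\mathsf K}(\overline p)\hookrightarrow F_{\mathsf K}(\overline p,\overline r)$, $F_{\mathsf K}(\overline p,\overline q)\hookrightarrow F_{\mathsf K}(\overline p,\overline q,\overline r)$ and $F_{\mathsf K}(\overline p,\overline r)\hookrightarrow F_{\mathsf K}(\overline p,\overline q,\overline r)$ induced by the inclusions of generators. The following are equivalent: (i) the V-formation $F_{\mathsf K}(\overline p,\overline q)\hookleftarrow F_{\mathsf K}(\overline p)\hookrightarrow F_{\mathsf K}(\overline p,\overline r)$ has a superamalgam in $\mathsf K$; (ii) $F_{\mathsf K}(\overline p,\overline q,\overline r)$ together with the natural embeddings of $F_{\mathsf K}(\overline p,\overline q)$ and $F_{\mathsf K}(\overline p,\overline r)$ is a superamalgam of that V-formation; (iii) for every $\phi\in Fm_{\overline p,\overline q}$ and $\psi\in Fm_{\overline p,\overline r}$ such that $\vDash_{\mathsf K}\phi\trianglelefteq\psi$, there is $\chi\in Fm_{\overline p}$ with $\vDash_{\mathsf K}\phi\trianglelefteq\chi$ and $\vDash_{\mathsf K}\chi\trianglelefteq\psi$.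
   Context: A modal lattice is a bounded lattice $(A,\top,\bot,\wedge,\vee)$ with unary operations $\Box,\Diamond$ satisfying $\Box\top=\top$, $\Diamond\top=\top$, $\Box a\wedge\Box b=\Box(a\wedge b)$, $\Diamond a\vee\Diamond b\le\Diamond(a\vee b)$, $\Diamond a\wedge\Box b\le\Diamond(a\wedge b)$; homomorphisms preserve all operations. For a set $P$ of propositional letters, $Fm_P$ is the set of formulas built from $P$ by the grammar $p\mid\top\mid\bot\mid\phi\wedge\psi\mid\phi\vee\psi\mid\Box\phi\mid\Diamond\phi$; $Fm_{\overline p,\overline q}$ denotes $Fm_{\overline p\cup\overline q}$, etc. A consequence pair is an expression $\phi\trianglelefteq\psi$ with $\phi,\psi$ formulas. A modal lattice $A$ validates $\phi\trianglelefteq\psi$ if $\sigma(\phi)\le\sigma(\psi)$ for every homomorphism (valuation) $\sigma$ from the formula algebra to $A$; $\vDash_{\mathsf K}\phi\trianglelefteq\psi$ means every member of $\mathsf K$ validates it. A V-formation in $\mathsf K$ consists of $K,L_1,L_2\in\mathsf K$ and injective homomorphisms $h_i\colon K\to L_i$. A superamalgam of it is some $M\in\mathsf K$ with injective homomorphisms $p_i\colon L_i\to M$ such that $p_1\circ h_1=p_2\circ h_2$ and such that whenever $a\in L_1$, $b\in L_2$ and $p_1(a)\le p_2(b)$, there is $c\in K$ with $a\le h_1(c)$ and $h_2(c)\le b$. -}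

module Defs where

open import Level using (0ℓ) renaming (suc to lsuc)
open import Data.Nat using (ℕ)
open import Data.Product using (Σ; _×_; _,_; ∃)
open import Data.Sum using (_⊎_; inj₁; inj₂)
open import Relation.Binary.Structures using (IsEquivalence)
open import Relation.Binary.PropositionalEquality as PE using (_≡_)
open import Algebra.Core using (Op₁; Op₂)
import Algebra.Definitions as AD
open import Algebra.Lattice.Structures using (IsLattice)

infixr 7 _∧_
infixr 6 _∨_

data Fm (X : Set) : Set where
  var     : X → Fm X
  ⊤ ⊥     : Fm X
  _∧_ _∨_ : Fm X → Fm X → Fm X
  □ ◇     : Fm X → Fm X

substF : {X Y : Set} → (X → Fm Y) → Fm X → Fm Y
substF σ (var x) = σ x
substF σ ⊤ = ⊤
substF σ ⊥ = ⊥
substF σ (a ∧ b) = substF σ a ∧ substF σ b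
substF σ (a ∨ b) = substF σ a ∨ substF σ b
substF σ (□ a) = □ (substF σ a)
substF σ (◇ a) = ◇ (substF σ a)

rename : {X Y : Set} → (X → Y) → Fm X → Fm Y
rename f = substF (λ x → var (f x))

record ModalLattice : Set₁ where
  infixr 7 _⊓_
  infixr 6 _⊔_
  infix 4 _≈_ _≤_
  field
    Carrier : Set
    _≈_     : Carrier → Carrier → Set
    top bot : Carrier
    _⊓_ _⊔_ : Op₂ Carrier
    box dia : Op₁ Carrier
  _≤_ : Carrier → Carrier → Set
  a ≤ b = (a ⊓ b) ≈ a
  field
    isLattice  : IsLattice _≈_ _⊔_ _⊓_
    ⊓-identity : AD.Identity _≈_ top _⊓_
    ⊔-identity : AD.Identity _≈_ bot _⊔_
    box-cong   : AD.Congruent₁ _≈_ box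
    dia-cong   : AD.Congruent₁ _≈_ dia
    box-top    : box top ≈ top
    dia-top    : dia top ≈ top
    box-⊓      : ∀ a b → (box a ⊓ box b) ≈ box (a ⊓ b)
    dia-⊔      : ∀ a b → (dia a ⊔ dia b) ≤ dia (a ⊔ b)
    dia-box    : ∀ a b → (dia a ⊓ box b) ≤ dia (a ⊓ b)

open ModalLattice public using (Carrier)

⟦_⟧ : {X : Set} (A : ModalLattice) → Fm X → (X → Carrier A) → Carrier A
⟦_⟧ A (var x) v = v x
⟦_⟧ A ⊤ v = ModalLattice.top A
⟦_⟧ A ⊥ v = ModalLattice.bot A
⟦_⟧ A (a ∧ b) v = ModalLattice._⊓_ A (⟦ A ⟧ a v) (⟦ A ⟧ b v)
⟦_⟧ A (a ∨ b) v = ModalLattice._⊔_ A (⟦ A ⟧ a v) (⟦ A ⟧ b v)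
⟦_⟧ A (□ a) v = ModalLattice.box A (⟦ A ⟧ a v)
⟦_⟧ A (◇ a) v = ModalLattice.dia A (⟦ A ⟧ a v)

record Hom (A B : ModalLattice) : Set where
  private
    module A = ModalLattice A
    module B = ModalLattice B
  field
    fun    : Carrier A → Carrier B
    cong   : ∀ {a b} → a A.≈ b → fun a B.≈ fun b
    pres-⊤ : fun A.top B.≈ B.top
    pres-⊥ : fun A.bot B.≈ B.bot
    pres-⊓ : ∀ a b → fun (a A.⊓ b) B.≈ (fun a B.⊓ fun b)
    pres-⊔ : ∀ a b → fun (a A.⊔ b) B.≈ (fun a B.⊔ fun b)
    pres-□ : ∀ a → fun (A.box a) B.≈ B.box (fun a)
    pres-◇ : ∀ a → fun (A.dia a) B.≈ B.dia (fun a)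

open Hom public

Injective : {A B : ModalLattice} → Hom A B → Set
Injective {A} {B} h =
  ∀ a b → ModalLattice._≈_ B (fun h a) (fun h b) → ModalLattice._≈_ A a b

-- Varieties of modal lattices: classes of modal lattices axiomatised by
-- a set E of identities s ≈ t in the countably many letters ℕ.

Identities : Set₁
Identities = Fm ℕ → Fm ℕ → Set

InK : Identities → ModalLattice → Set
InK E A = ∀ s t → E s t → ∀ (v : ℕ → Carrier A) →
          ModalLattice._≈_ A (⟦ A ⟧ s v) (⟦ A ⟧ t v)

_⊨_⊴_ : {X : Set} → Identities → Fm X → Fm X → Set₁
_⊨_⊴_ {X} E φ ψ = ∀ (A : ModalLattice) → InK E A → ∀ (v : X → Carrier A) →
                  ModalLattice._≤_ A (⟦ A ⟧ φ v) (⟦ A ⟧ ψ v)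

-- Free algebra F_K(X): formulas over X modulo the fully invariant
-- congruence generated by the modal-lattice axioms and E
-- (equational derivability).

infix 4 _⊢_≈_

data _⊢_≈_ {X : Set} (E : Identities) : Fm X → Fm X → Set where
  ≈-refl  : ∀ {a} → E ⊢ a ≈ a
  ≈-sym   : ∀ {a b} → E ⊢ a ≈ b → E ⊢ b ≈ a
  ≈-trans : ∀ {a b c} → E ⊢ a ≈ b → E ⊢ b ≈ c → E ⊢ a ≈ c
  ∧-cong  : ∀ {a a' b b'} → E ⊢ a ≈ a' → E ⊢ b ≈ b' → E ⊢ a ∧ b ≈ a' ∧ b'
  ∨-cong  : ∀ {a a' b b'} → E ⊢ a ≈ a' → E ⊢ b ≈ b' → E ⊢ a ∨ b ≈ a' ∨ b'
  □-cong  : ∀ {a b} → E ⊢ a ≈ b → E ⊢ □ a ≈ □ b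
  ◇-cong  : ∀ {a b} → E ⊢ a ≈ b → E ⊢ ◇ a ≈ ◇ b
  ∧-comm  : ∀ a b → E ⊢ a ∧ b ≈ b ∧ a
  ∨-comm  : ∀ a b → E ⊢ a ∨ b ≈ b ∨ a
  ∧-assoc : ∀ a b c → E ⊢ (a ∧ b) ∧ c ≈ a ∧ (b ∧ c)
  ∨-assoc : ∀ a b c → E ⊢ (a ∨ b) ∨ c ≈ a ∨ (b ∨ c)
  ∨-abs-∧ : ∀ a b → E ⊢ a ∨ (a ∧ b) ≈ a
  ∧-abs-∨ : ∀ a b → E ⊢ a ∧ (a ∨ b) ≈ a
  ⊤-idˡ   : ∀ a → E ⊢ ⊤ ∧ a ≈ a
  ⊤-idʳ   : ∀ a → E ⊢ a ∧ ⊤ ≈ a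
  ⊥-idˡ   : ∀ a → E ⊢ ⊥ ∨ a ≈ a
  ⊥-idʳ   : ∀ a → E ⊢ a ∨ ⊥ ≈ a
  □⊤      : E ⊢ □ ⊤ ≈ ⊤
  ◇⊤      : E ⊢ ◇ ⊤ ≈ ⊤
  □∧      : ∀ a b → E ⊢ □ a ∧ □ b ≈ □ (a ∧ b)
  ◇∨      : ∀ a b → E ⊢ (◇ a ∨ ◇ b) ∧ ◇ (a ∨ b) ≈ ◇ a ∨ ◇ b
  ◇□      : ∀ a b → E ⊢ (◇ a ∧ □ b) ∧ ◇ (a ∧ b) ≈ ◇ a ∧ □ b
  axiom   : ∀ {s t} → E s t → (σ : ℕ → Fm X) → E ⊢ substF σ s ≈ substF σ t

Free : Identities → Set → ModalLattice
Free E X = record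
  { Carrier = Fm X
  ; _≈_ = E ⊢_≈_
  ; top = ⊤ ; bot = ⊥ ; _⊓_ = _∧_ ; _⊔_ = _∨_ ; box = □ ; dia = ◇
  ; isLattice = record
    { isEquivalence = record { refl = ≈-refl ; sym = ≈-sym ; trans = ≈-trans }
    ; ∨-comm = ∨-comm ; ∨-assoc = ∨-assoc ; ∨-cong = ∨-cong
    ; ∧-comm = ∧-comm ; ∧-assoc = ∧-assoc ; ∧-cong = ∧-cong
    ; absorptive = ∨-abs-∧ , ∧-abs-∨ }
  ; ⊓-identity = ⊤-idˡ , ⊤-idʳ
  ; ⊔-identity = ⊥-idˡ , ⊥-idʳ
  ; box-cong = □-cong ; dia-cong = ◇-cong
  ; box-top = □⊤ ; dia-top = ◇⊤
  ; box-⊓ = □∧ ; dia-⊔ = ◇∨ ; dia-box = ◇□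
  }

substF-substF : {X Y Z : Set} (τ : Y → Fm Z) (σ : X → Fm Y) (a : Fm X) →
  substF τ (substF σ a) ≡ substF (λ x → substF τ (σ x)) a
substF-substF τ σ (var x) = PE.refl
substF-substF τ σ ⊤ = PE.refl
substF-substF τ σ ⊥ = PE.refl
substF-substF τ σ (a ∧ b) = PE.cong₂ _∧_ (substF-substF τ σ a) (substF-substF τ σ b)
substF-substF τ σ (a ∨ b) = PE.cong₂ _∨_ (substF-substF τ σ a) (substF-substF τ σ b)
substF-substF τ σ (□ a) = PE.cong □ (substF-substF τ σ a)
substF-substF τ σ (◇ a) = PE.cong ◇ (substF-substF τ σ a)

substF-cong : {E : Identities} {X Y : Set} (τ : X → Fm Y) {a b : Fm X} →
  E ⊢ a ≈ b → E ⊢ substF τ a ≈ substF τ b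
substF-cong τ ≈-refl = ≈-refl
substF-cong τ (≈-sym p) = ≈-sym (substF-cong τ p)
substF-cong τ (≈-trans p q) = ≈-trans (substF-cong τ p) (substF-cong τ q)
substF-cong τ (∧-cong p q) = ∧-cong (substF-cong τ p) (substF-cong τ q)
substF-cong τ (∨-cong p q) = ∨-cong (substF-cong τ p) (substF-cong τ q)
substF-cong τ (□-cong p) = □-cong (substF-cong τ p)
substF-cong τ (◇-cong p) = ◇-cong (substF-cong τ p)
substF-cong τ (∧-comm a b) = ∧-comm _ _
substF-cong τ (∨-comm a b) = ∨-comm _ _
substF-cong τ (∧-assoc a b c) = ∧-assoc _ _ _
substF-cong τ (∨-assoc a b c) = ∨-assoc _ _ _
substF-cong τ (∨-abs-∧ a b) = ∨-abs-∧ _ _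
substF-cong τ (∧-abs-∨ a b) = ∧-abs-∨ _ _
substF-cong τ (⊤-idˡ a) = ⊤-idˡ _
substF-cong τ (⊤-idʳ a) = ⊤-idʳ _
substF-cong τ (⊥-idˡ a) = ⊥-idˡ _
substF-cong τ (⊥-idʳ a) = ⊥-idʳ _
substF-cong τ □⊤ = □⊤
substF-cong τ ◇⊤ = ◇⊤
substF-cong τ (□∧ a b) = □∧ _ _
substF-cong τ (◇∨ a b) = ◇∨ _ _
substF-cong τ (◇□ a b) = ◇□ _ _
substF-cong {E} τ (axiom {s} {t} e σ) =
  PE.subst₂ (E ⊢_≈_) (PE.sym (substF-substF τ σ s)) (PE.sym (substF-substF τ σ t))
    (axiom e (λ n → substF τ (σ n)))

natHom : (E : Identities) {X Y : Set} → (X → Y) → Hom (Free E X) (Free E Y)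
natHom E f = record
  { fun = rename f
  ; cong = substF-cong (λ x → var (f x))
  ; pres-⊤ = ≈-refl ; pres-⊥ = ≈-refl
  ; pres-⊓ = λ _ _ → ≈-refl ; pres-⊔ = λ _ _ → ≈-refl
  ; pres-□ = λ _ → ≈-refl ; pres-◇ = λ _ → ≈-refl
  }

record IsSuperamalgam (E : Identities) {K L₁ L₂ : ModalLattice}
    (h₁ : Hom K L₁) (h₂ : Hom K L₂)
    (M : ModalLattice) (p₁ : Hom L₁ M) (p₂ : Hom L₂ M) : Set where
  field
    M∈K     : InK E M
    p₁-inj  : Injective p₁
    p₂-inj  : Injective p₂
    commute : ∀ c → ModalLattice._≈_ M (fun p₁ (fun h₁ c)) (fun p₂ (fun h₂ c))
    super   : ∀ a b → ModalLattice._≤_ M (fun p₁ a) (fun p₂ b) →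
              Σ (Carrier K) λ c → ModalLattice._≤_ L₁ a (fun h₁ c)
                                × ModalLattice._≤_ L₂ (fun h₂ c) b

HasSuperamalgam : (E : Identities) {K L₁ L₂ : ModalLattice}
    (h₁ : Hom K L₁) (h₂ : Hom K L₂) → Set₁
HasSuperamalgam E {K} {L₁} {L₂} h₁ h₂ =
  Σ ModalLattice λ M → Σ (Hom L₁ M) λ p₁ → Σ (Hom L₂ M) λ p₂ →
    IsSuperamalgam E h₁ h₂ M p₁ p₂

-- The letter inclusions for p̄, q̄, r̄ (pairwise disjoint by construction:
-- the letters of p̄,q̄,r̄ are the three summands of P ⊎ (Q ⊎ R))

ι-p-pq : {P Q : Set} → P → P ⊎ Q
ι-p-pq = inj₁

ι-p-pr : {P R : Set} → P → P ⊎ R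
ι-p-pr = inj₁

ι-pq-pqr : {P Q R : Set} → P ⊎ Q → P ⊎ (Q ⊎ R)
ι-pq-pqr (inj₁ p) = inj₁ p
ι-pq-pqr (inj₂ q) = inj₂ (inj₁ q)

ι-pr-pqr : {P Q R : Set} → P ⊎ R → P ⊎ (Q ⊎ R)
ι-pr-pqr (inj₁ p) = inj₁ p
ι-pr-pqr (inj₂ r) = inj₂ (inj₂ r)

ι-p-pqr : {P Q R : Set} → P → P ⊎ (Q ⊎ R)
ι-p-pqr = inj₁

{-# OPTIONS --safe #-}
-- The free algebra F_K(p̄,q̄,r̄) lies in K, its order is exactly K-consequence
-- (a ≤ b iff ⊨_K a ⊴ b), and the natural maps into it are injective because
-- substituting ⊤ for the missing letters retracts them. So (ii) is (iii) read
-- inside the free algebra. Conversely, in any superamalgam M the embeddings p₁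
-- and p₂ agree on p̄, so together they give one valuation of p̄,q̄,r̄ in M; under
-- it a K-valid φ ⊴ ψ becomes p₁ φ ≤ p₂ ψ, and the superamalgam property yields
-- the interpolant.
module Submission where

open import Defs
open import Data.Product using (Σ; _×_; _,_; proj₁; proj₂)
open import Data.Sum using (_⊎_; inj₁; inj₂)
open import Function.Base using (_∘_)
open import Function.Bundles using (_⇔_; mk⇔; Equivalence)
open import Function.Properties.Equivalence using () renaming (trans to ⇔-trans)
open import Relation.Binary.PropositionalEquality as PE using (_≡_)
open import Algebra.Lattice.Structures using (IsLattice)

module _ (A : ModalLattice) where
  open ModalLattice A
  private module L = IsLattice isLattice
  open L using (refl; sym; trans)

  ⟦⟧-substF : {X Y : Set} (σ : X → Fm Y) (φ : Fm X) (v : Y → Carrier A) →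
    ⟦ A ⟧ (substF σ φ) v ≡ ⟦ A ⟧ φ (λ x → ⟦ A ⟧ (σ x) v)
  ⟦⟧-substF σ (var x) v = PE.refl
  ⟦⟧-substF σ ⊤ v = PE.refl
  ⟦⟧-substF σ ⊥ v = PE.refl
  ⟦⟧-substF σ (a ∧ b) v = PE.cong₂ _⊓_ (⟦⟧-substF σ a v) (⟦⟧-substF σ b v)
  ⟦⟧-substF σ (a ∨ b) v = PE.cong₂ _⊔_ (⟦⟧-substF σ a v) (⟦⟧-substF σ b v)
  ⟦⟧-substF σ (□ a) v = PE.cong box (⟦⟧-substF σ a v)
  ⟦⟧-substF σ (◇ a) v = PE.cong dia (⟦⟧-substF σ a v)

  ⟦⟧-rename : {X Y : Set} (f : X → Y) (φ : Fm X) (v : Y → Carrier A) →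
    ⟦ A ⟧ (rename f φ) v ≡ ⟦ A ⟧ φ (v ∘ f)
  ⟦⟧-rename f = ⟦⟧-substF (var ∘ f)

  Hom≈⟦⟧ : {E : Identities} {X : Set} (h : Hom (Free E X) A) {v : X → Carrier A} →
    (∀ x → fun h (var x) ≈ v x) → ∀ φ → fun h φ ≈ ⟦ A ⟧ φ v
  Hom≈⟦⟧ h hv (var x) = hv x
  Hom≈⟦⟧ h hv ⊤ = pres-⊤ h
  Hom≈⟦⟧ h hv ⊥ = pres-⊥ h
  Hom≈⟦⟧ h hv (a ∧ b) = trans (pres-⊓ h a b) (L.∧-cong (Hom≈⟦⟧ h hv a) (Hom≈⟦⟧ h hv b))
  Hom≈⟦⟧ h hv (a ∨ b) = trans (pres-⊔ h a b) (L.∨-cong (Hom≈⟦⟧ h hv a) (Hom≈⟦⟧ h hv b))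
  Hom≈⟦⟧ h hv (□ a) = trans (pres-□ h a) (box-cong (Hom≈⟦⟧ h hv a))
  Hom≈⟦⟧ h hv (◇ a) = trans (pres-◇ h a) (dia-cong (Hom≈⟦⟧ h hv a))

  ⟦⟧-sound : {E : Identities} {X : Set} → InK E A → {a b : Fm X} → E ⊢ a ≈ b →
    ∀ v → ⟦ A ⟧ a v ≈ ⟦ A ⟧ b v
  ⟦⟧-sound A∈K ≈-refl v = refl
  ⟦⟧-sound A∈K (≈-sym p) v = sym (⟦⟧-sound A∈K p v)
  ⟦⟧-sound A∈K (≈-trans p q) v = trans (⟦⟧-sound A∈K p v) (⟦⟧-sound A∈K q v)
  ⟦⟧-sound A∈K (∧-cong p q) v = L.∧-cong (⟦⟧-sound A∈K p v) (⟦⟧-sound A∈K q v)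
  ⟦⟧-sound A∈K (∨-cong p q) v = L.∨-cong (⟦⟧-sound A∈K p v) (⟦⟧-sound A∈K q v)
  ⟦⟧-sound A∈K (□-cong p) v = box-cong (⟦⟧-sound A∈K p v)
  ⟦⟧-sound A∈K (◇-cong p) v = dia-cong (⟦⟧-sound A∈K p v)
  ⟦⟧-sound A∈K (∧-comm a b) v = L.∧-comm _ _
  ⟦⟧-sound A∈K (∨-comm a b) v = L.∨-comm _ _
  ⟦⟧-sound A∈K (∧-assoc a b c) v = L.∧-assoc _ _ _
  ⟦⟧-sound A∈K (∨-assoc a b c) v = L.∨-assoc _ _ _
  ⟦⟧-sound A∈K (∨-abs-∧ a b) v = L.∨-absorbs-∧ _ _
  ⟦⟧-sound A∈K (∧-abs-∨ a b) v = L.∧-absorbs-∨ _ _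
  ⟦⟧-sound A∈K (⊤-idˡ a) v = proj₁ ⊓-identity _
  ⟦⟧-sound A∈K (⊤-idʳ a) v = proj₂ ⊓-identity _
  ⟦⟧-sound A∈K (⊥-idˡ a) v = proj₁ ⊔-identity _
  ⟦⟧-sound A∈K (⊥-idʳ a) v = proj₂ ⊔-identity _
  ⟦⟧-sound A∈K □⊤ v = box-top
  ⟦⟧-sound A∈K ◇⊤ v = dia-top
  ⟦⟧-sound A∈K (□∧ a b) v = box-⊓ _ _
  ⟦⟧-sound A∈K (◇∨ a b) v = dia-⊔ _ _
  ⟦⟧-sound A∈K (◇□ a b) v = dia-box _ _
  ⟦⟧-sound A∈K (axiom {s} {t} e σ) v =
    PE.subst₂ _≈_ (PE.sym (⟦⟧-substF σ s v)) (PE.sym (⟦⟧-substF σ t v))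
      (A∈K s t e (λ n → ⟦ A ⟧ (σ n) v))

  ≤-resp-≈ : ∀ {a a′ b b′} → a ≈ a′ → b ≈ b′ → a′ ≤ b′ → a ≤ b
  ≤-resp-≈ a≈a′ b≈b′ a′≤b′ = trans (L.∧-cong a≈a′ b≈b′) (trans a′≤b′ (sym a≈a′))

Injective-≤⇔ : {A B : ModalLattice} (h : Hom A B) → Injective h →
  ∀ {a b} → ModalLattice._≤_ A a b ⇔ ModalLattice._≤_ B (fun h a) (fun h b)
Injective-≤⇔ {A} {B} h h-inj {a} {b} = mk⇔
  (λ a≤b → B.trans (B.sym (pres-⊓ h a b)) (cong h a≤b))
  (λ ha≤hb → h-inj (a ⊓ b) a (B.trans (pres-⊓ h a b) ha≤hb))
  where
  open ModalLattice A using (_⊓_)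
  module B = IsLattice (ModalLattice.isLattice B)

⊢-reflexive : {E : Identities} {X : Set} {a b : Fm X} → a ≡ b → E ⊢ a ≈ b
⊢-reflexive PE.refl = ≈-refl

substF-identity : {X : Set} {σ : X → Fm X} → (∀ x → σ x ≡ var x) →
  ∀ φ → substF σ φ ≡ φ
substF-identity e (var x) = e x
substF-identity e ⊤ = PE.refl
substF-identity e ⊥ = PE.refl
substF-identity e (a ∧ b) = PE.cong₂ _∧_ (substF-identity e a) (substF-identity e b)
substF-identity e (a ∨ b) = PE.cong₂ _∨_ (substF-identity e a) (substF-identity e b)
substF-identity e (□ a) = PE.cong □ (substF-identity e a)
substF-identity e (◇ a) = PE.cong ◇ (substF-identity e a)

rename-∘ : {X Y Z : Set} (g : Y → Z) (f : X → Y) (φ : Fm X) →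
  rename g (rename f φ) ≡ rename (g ∘ f) φ
rename-∘ g f = substF-substF (var ∘ g) (var ∘ f)

⟦⟧-Free : {E : Identities} {X Y : Set} (φ : Fm X) (σ : X → Fm Y) →
  ⟦ Free E Y ⟧ φ σ ≡ substF σ φ
⟦⟧-Free (var x) σ = PE.refl
⟦⟧-Free ⊤ σ = PE.refl
⟦⟧-Free ⊥ σ = PE.refl
⟦⟧-Free (a ∧ b) σ = PE.cong₂ _∧_ (⟦⟧-Free a σ) (⟦⟧-Free b σ)
⟦⟧-Free (a ∨ b) σ = PE.cong₂ _∨_ (⟦⟧-Free a σ) (⟦⟧-Free b σ)
⟦⟧-Free (□ a) σ = PE.cong □ (⟦⟧-Free a σ)
⟦⟧-Free (◇ a) σ = PE.cong ◇ (⟦⟧-Free a σ)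

Free∈K : (E : Identities) (X : Set) → InK E (Free E X)
Free∈K E X s t e σ =
  PE.subst₂ (E ⊢_≈_) (PE.sym (⟦⟧-Free s σ)) (PE.sym (⟦⟧-Free t σ)) (axiom e σ)

Free-≤⇔⊨ : {E : Identities} {X : Set} {φ ψ : Fm X} →
  ModalLattice._≤_ (Free E X) φ ψ ⇔ E ⊨ φ ⊴ ψ
Free-≤⇔⊨ {E} {X} {φ} {ψ} = mk⇔ (λ φ≤ψ A A∈K → ⟦⟧-sound A A∈K φ≤ψ) ⊨⇒≤
  where
  ⟦⟧-generic : ∀ a → ⟦ Free E X ⟧ a var ≡ a
  ⟦⟧-generic a = PE.trans (⟦⟧-Free a var) (substF-identity (λ _ → PE.refl) a)

  ⊨⇒≤ : E ⊨ φ ⊴ ψ → E ⊢ φ ∧ ψ ≈ φ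
  ⊨⇒≤ φ⊨ψ = PE.subst₂ (λ a b → E ⊢ a ∧ b ≈ a) (⟦⟧-generic φ) (⟦⟧-generic ψ)
    (φ⊨ψ (Free E X) (Free∈K E X) var)

natHom-injective : (E : Identities) {X Y : Set} (f : X → Y) (r : Y → Fm X) →
  (∀ x → r (f x) ≡ var x) → Injective (natHom E f)
natHom-injective E f r r∘f≡var a b fa≈fb =
  PE.subst₂ (E ⊢_≈_) (retract a) (retract b) (substF-cong r fa≈fb)
  where
  retract : ∀ a → substF r (rename f a) ≡ a
  retract a = PE.trans (substF-substF r (var ∘ f) a) (substF-identity r∘f≡var a)

module _ (E : Identities) (P Q R : Set) where
  PQR : Set
  PQR = P ⊎ (Q ⊎ R)

  h₁ : Hom (Free E P) (Free E (P ⊎ Q))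
  h₁ = natHom E ι-p-pq

  h₂ : Hom (Free E P) (Free E (P ⊎ R))
  h₂ = natHom E ι-p-pr

  e₁ : Hom (Free E (P ⊎ Q)) (Free E PQR)
  e₁ = natHom E ι-pq-pqr

  e₂ : Hom (Free E (P ⊎ R)) (Free E PQR)
  e₂ = natHom E ι-pr-pqr

  Interpolation : Set₁
  Interpolation = ∀ (φ : Fm (P ⊎ Q)) (ψ : Fm (P ⊎ R)) →
    E ⊨ rename ι-pq-pqr φ ⊴ rename ι-pr-pqr ψ →
    Σ (Fm P) λ χ → (E ⊨ rename ι-pq-pqr φ ⊴ rename (ι-p-pqr {P} {Q} {R}) χ)
                 × (E ⊨ rename (ι-p-pqr {P} {Q} {R}) χ ⊴ rename ι-pr-pqr ψ)

  e₁∘h₁≡ι-p-pqr : ∀ χ → fun e₁ (fun h₁ χ) ≡ rename (ι-p-pqr {P} {Q} {R}) χ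
  e₁∘h₁≡ι-p-pqr = rename-∘ ι-pq-pqr ι-p-pq

  e₂∘h₂≡ι-p-pqr : ∀ χ → fun e₂ (fun h₂ χ) ≡ rename (ι-p-pqr {P} {Q} {R}) χ
  e₂∘h₂≡ι-p-pqr = rename-∘ ι-pr-pqr ι-p-pr

  e₁-injective : Injective e₁
  e₁-injective = natHom-injective E ι-pq-pqr forget-r
    λ { (inj₁ _) → PE.refl ; (inj₂ _) → PE.refl }
    where
    forget-r : PQR → Fm (P ⊎ Q)
    forget-r (inj₁ p) = var (inj₁ p)
    forget-r (inj₂ (inj₁ q)) = var (inj₂ q)
    forget-r (inj₂ (inj₂ r)) = ⊤

  e₂-injective : Injective e₂
  e₂-injective = natHom-injective E ι-pr-pqr forget-q
    λ { (inj₁ _) → PE.refl ; (inj₂ _) → PE.refl }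
    where
    forget-q : PQR → Fm (P ⊎ R)
    forget-q (inj₁ p) = var (inj₁ p)
    forget-q (inj₂ (inj₁ q)) = ⊤
    forget-q (inj₂ (inj₂ r)) = var (inj₂ r)

  ≤h₁⇔⊨ : ∀ φ χ → ModalLattice._≤_ (Free E (P ⊎ Q)) φ (fun h₁ χ) ⇔
    E ⊨ rename ι-pq-pqr φ ⊴ rename (ι-p-pqr {P} {Q} {R}) χ
  ≤h₁⇔⊨ φ χ rewrite PE.sym (e₁∘h₁≡ι-p-pqr χ) =
    ⇔-trans (Injective-≤⇔ e₁ e₁-injective) Free-≤⇔⊨

  h₂≤⇔⊨ : ∀ χ ψ → ModalLattice._≤_ (Free E (P ⊎ R)) (fun h₂ χ) ψ ⇔
    E ⊨ rename (ι-p-pqr {P} {Q} {R}) χ ⊴ rename ι-pr-pqr ψ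
  h₂≤⇔⊨ χ ψ rewrite PE.sym (e₂∘h₂≡ι-p-pqr χ) =
    ⇔-trans (Injective-≤⇔ e₂ e₂-injective) Free-≤⇔⊨

  superamalgam⇒interpolation : HasSuperamalgam E h₁ h₂ → Interpolation
  superamalgam⇒interpolation (M , p₁ , p₂ , S) φ ψ φ⊨ψ =
    let χ , φ≤h₁χ , h₂χ≤ψ = super φ ψ p₁φ≤p₂ψ
    in  χ , Equivalence.to (≤h₁⇔⊨ φ χ) φ≤h₁χ , Equivalence.to (h₂≤⇔⊨ χ ψ) h₂χ≤ψ
    where
    open ModalLattice M using (_≈_; _≤_; isLattice)
    open IsLattice isLattice using (refl; sym)
    open IsSuperamalgam S

    w : PQR → Carrier M
    w (inj₁ p) = fun p₁ (var (inj₁ p))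
    w (inj₂ (inj₁ q)) = fun p₁ (var (inj₂ q))
    w (inj₂ (inj₂ r)) = fun p₂ (var (inj₂ r))

    p₁-agrees : ∀ x → fun p₁ (var x) ≈ w (ι-pq-pqr x)
    p₁-agrees (inj₁ p) = refl
    p₁-agrees (inj₂ q) = refl

    p₂-agrees : ∀ x → fun p₂ (var x) ≈ w (ι-pr-pqr x)
    p₂-agrees (inj₁ p) = sym (commute (var p))
    p₂-agrees (inj₂ r) = refl

    p₁φ≤p₂ψ : fun p₁ φ ≤ fun p₂ ψ
    p₁φ≤p₂ψ = ≤-resp-≈ M (Hom≈⟦⟧ M p₁ p₁-agrees φ) (Hom≈⟦⟧ M p₂ p₂-agrees ψ)
      (PE.subst₂ _≤_ (⟦⟧-rename M ι-pq-pqr φ w) (⟦⟧-rename M ι-pr-pqr ψ w) (φ⊨ψ M M∈K w))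

  interpolation⇒free-superamalgam : Interpolation →
    IsSuperamalgam E h₁ h₂ (Free E PQR) e₁ e₂
  interpolation⇒free-superamalgam interpolate = record
    { M∈K = Free∈K E PQR
    ; p₁-inj = e₁-injective
    ; p₂-inj = e₂-injective
    ; commute = λ χ → ⊢-reflexive (PE.trans (e₁∘h₁≡ι-p-pqr χ) (PE.sym (e₂∘h₂≡ι-p-pqr χ)))
    ; super = λ φ ψ e₁φ≤e₂ψ →
        let χ , φ⊨χ , χ⊨ψ = interpolate φ ψ (Equivalence.to Free-≤⇔⊨ e₁φ≤e₂ψ)
        in  χ , Equivalence.from (≤h₁⇔⊨ φ χ) φ⊨χ , Equivalence.from (h₂≤⇔⊨ χ ψ) χ⊨ψ
    }

lemma2p15 : (E : Identities) (P Q R : Set) →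
    (HasSuperamalgam E (natHom E (ι-p-pq {P} {Q})) (natHom E (ι-p-pr {P} {R}))
      ⇔ IsSuperamalgam E (natHom E (ι-p-pq {P} {Q})) (natHom E (ι-p-pr {P} {R}))
          (Free E (P ⊎ (Q ⊎ R))) (natHom E ι-pq-pqr) (natHom E ι-pr-pqr))
    × (IsSuperamalgam E (natHom E (ι-p-pq {P} {Q})) (natHom E (ι-p-pr {P} {R}))
          (Free E (P ⊎ (Q ⊎ R))) (natHom E ι-pq-pqr) (natHom E ι-pr-pqr)
      ⇔ (∀ (φ : Fm (P ⊎ Q)) (ψ : Fm (P ⊎ R)) →
           E ⊨ rename ι-pq-pqr φ ⊴ rename (ι-pr-pqr {P} {Q} {R}) ψ →
           Σ (Fm P) λ χ → (E ⊨ rename (ι-pq-pqr {P} {Q} {R}) φ ⊴ rename ι-p-pqr χ)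
                        × (E ⊨ rename (ι-p-pqr {P} {Q} {R}) χ ⊴ rename ι-pr-pqr ψ)))
lemma2p15 E P Q R =
    mk⇔ (interpolation⇒free-superamalgam E P Q R ∘ superamalgam⇒interpolation E P Q R)
        (λ S → _ , _ , _ , S)
  , mk⇔ (λ S → superamalgam⇒interpolation E P Q R (_ , _ , _ , S))
        (interpolation⇒free-superamalgam E P Q R)
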